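{- Let $m\ge1$ and $n\ge m+2$ be integers and $H$ a finite simple graph. Then $$\gamma_{gr}(P_n^m\circ H)=\begin{cases}\left\lceil\frac{n}{m+1}\right\rceil(\gamma_{gr}(H)-(m+1))+n+m & \text{if }\gamma_{gr}(H)\ge m+1,\\[2pt] 2\gamma_{gr}(H)+n-m-2 & \text{if }\gamma_{gr}(H)\le m.\end{cases}$$
   Context: $P_n^m$ is the $m$-th power of the path $P_n$ on $[n]$ (vertices $i,j$ adjacent iff $|i-j|\le m$). The lexicographic product $G\circ H$ has vertex set $V(G)\times V(H)$, with $(g_1,h_1)\sim(g_2,h_2)$ iff $g_1g_2\in E(G)$, or $g_1=g_2$ and $h_1h_2\in E(H)$. For a sequence $S=(v_1,\dots,v_k)$ of distinct vertices, $PN_S(v_i)=N[v_i]\setminus\bigcup_{j<i}N[v_j]$; $S$ is legal dominating if $\{v_1,\dots,v_k\}$ dominates the graph and each $PN_S(v_i)\ne\emptyset$; $\gamma_{gr}$ is the maximum length of such a sequence. -}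

module Defs where

open import Data.Nat using (ℕ; zero; suc; _+_; _*_; _∸_; _≤_; _<_; _/_)
open import Data.Nat.Properties using (_≟_)
open import Data.Fin using (Fin; toℕ)
open import Data.Bool using (Bool; true; false; _∧_; _∨_; T; not)
open import Data.Product using (_×_; _,_; proj₁; proj₂; Σ; ∃)
open import Data.Sum using (_⊎_)
open import Data.Unit using (⊤)
open import Data.List using (List; []; _∷_; length)
open import Data.List.Membership.Propositional using (_∈_)
open import Data.List.Relation.Unary.Unique.Propositional using (Unique)
open import Relation.Binary.PropositionalEquality using (_≡_)
open import Relation.Nullary using (¬_; does; Dec)
import Data.Fin as F
import Data.Product.Properties as PP

record Graph : Set₁ where
  field
    V    : Set
    _≟V_ : (u v : V) → Dec (u ≡ v)
    adj  : V → V → Bool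
open Graph public

record SimpleGraph (k : ℕ) : Set where
  field
    adjF   : Fin k → Fin k → Bool
    sym    : ∀ u v → adjF u v ≡ adjF v u
    irrefl : ∀ v → adjF v v ≡ false
open SimpleGraph public

toGraph : ∀ {k} → SimpleGraph k → Graph
toGraph {k} H = record { V = Fin k ; _≟V_ = F._≟_ ; adj = adjF H }

InN : (G : Graph) → V G → V G → Set
InN G v u = (u ≡ v) ⊎ T (adj G v u)

Dominated : (G : Graph) → List (V G) → V G → Set
Dominated G S u = ∃ λ w → w ∈ S × InN G w u

-- Lists are read with the head as the FIRST vertex v_1; we use the
-- reversed "prefix" argument `prev` holding v_1..v_{i-1}.
LegalFrom : (G : Graph) → List (V G) → List (V G) → Set
LegalFrom G prev []      = ⊤
LegalFrom G prev (v ∷ S) =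
  (∃ λ u → InN G v u × ¬ Dominated G prev u) × LegalFrom G (v ∷ prev) S

LegalDominating : (G : Graph) → List (V G) → Set
LegalDominating G S =
  Unique S × LegalFrom G [] S × (∀ u → Dominated G S u)

IsGrundyDom : (G : Graph) → ℕ → Set
IsGrundyDom G g =
  (∃ λ S → LegalDominating G S × length S ≡ g)
  × (∀ S → LegalDominating G S → length S ≤ g)

pathPow : (n m : ℕ) → Graph
pathPow n m = record
  { V   = Fin n
  ; _≟V_ = F._≟_
  ; adj = λ i j → not (does (toℕ i ≟ toℕ j))
                  ∧ (dist (toℕ i) (toℕ j) ≤ᵇ m) }
  where
  open import Data.Nat using (_≤ᵇ_)
  dist : ℕ → ℕ → ℕ
  dist a b = (a ∸ b) + (b ∸ a)

lex : Graph → Graph → Graph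
lex G H = record
  { V   = V G × V H
  ; _≟V_ = PP.≡-dec (_≟V_ G) (_≟V_ H)
  ; adj = λ p q → adj G (proj₁ p) (proj₁ q)
                  ∨ (does (_≟V_ G (proj₁ p) (proj₁ q)) ∧ adj H (proj₂ p) (proj₂ q)) }

module Submission where

-- Call {i} × V(H) the i-th layer of P_n^m ∘ H and write g = γ_gr(H).
--
-- Lower bound: play a Grundy sequence of H in layer 0, then one vertex in each layer j = 1, …, r (it
-- footprints layer j + m), then for a = 1, …, b replay that sequence without its last vertex y in layer
-- r + a(m + 1) and add a vertex m layers lower, which footprints the private neighbour of y. This needs
-- n = 1 + r + b(m + 1) and has length g + r + bg; take b = ⌊(n + m)/(m + 1)⌋ − 1, or b = 1 when g ≤ m.
--
-- Upper bound: as long as a layer is not dominated from another layer, its vertices form a legal sequence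
-- of H, so a layer absorbs at most g vertices. Call a vertex fresh when it lies more than m layers away from
-- all earlier ones. With p fresh vertices and e vertices footprinting a layer not yet within m layers of a
-- vertex, the sequence has length at most pg + e, while counting the points of [0, n + m) covered by the
-- windows [i, i + m] of the vertices gives (m + 1)p + e ≤ n + m, and counting layers gives m + p + e ≤ n
-- when p ≥ 1. Maximising pg + e under these constraints yields both formulas.

open import Defs hiding (sym)
open import Data.Nat using (ℕ; zero; suc; _+_; _*_; _∸_; _≤_; _<_; _/_; z≤n; s≤s; s≤s⁻¹; NonZero; >-nonZero)
open import Data.Nat.Properties
open import Data.Nat.DivMod using (m*n/n≡m; /-monoˡ-≤; m/n*n≤m)
open import Data.Nat.Tactic.RingSolver using (solve-∀)
open import Data.Product using (_×_; _,_; proj₁; proj₂; ∃; ∃₂)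
open import Data.Sum using (_⊎_; inj₁; inj₂)
open import Data.Unit using (⊤; tt)
open import Data.Empty using (⊥-elim)
open import Data.Bool using (T; not)
open import Data.Bool.Properties using (T?; T-∧; T-∨)
open import Data.Fin using (Fin; toℕ)
import Data.Fin as Fin
import Data.Fin.Properties as Fin
open import Data.List
  using (List; []; _∷_; length; map; filter; _++_; _ʳ++_; reverse; allFin; cartesianProduct; initLast; _∷ʳ′_)
open import Data.List.Properties
  using (map-++; length-++; length-map; length-ʳ++; length-reverse; filter-accept; filter-reject; filter-none)
open import Data.List.Membership.Propositional using (_∈_; find; lose)
open import Data.List.Membership.Propositional.Properties
  using (∈-map⁻; ∈-++⁻; ∈-filter⁻; ∈-allFin; ∈-cartesianProduct⁺)
open import Data.List.Relation.Unary.Any using (Any; here; there; any?)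
import Data.List.Relation.Unary.Any.Properties as Any
open import Data.List.Relation.Unary.All using (All; []; _∷_)
import Data.List.Relation.Unary.All as All
open import Data.List.Relation.Unary.All.Properties using (¬Any⇒All¬)
open import Data.List.Relation.Unary.AllPairs using ([]; _∷_)
open import Data.List.Relation.Unary.Unique.Propositional using (Unique)
open import Function using (_∘_; id)
open import Function.Bundles using (Equivalence)
open import Relation.Binary.PropositionalEquality
  using (_≡_; refl; sym; trans; cong; cong₂; subst; subst₂; module ≡-Reasoning)
open import Relation.Nullary using (¬_; Dec; yes; no; does)
open import Relation.Nullary.Decidable using (_⊎-dec_; _×-dec_; ¬?; map′)

∈-ʳ++⁻ : ∀ {A : Set} {w : A} S hist → w ∈ S ʳ++ hist → w ∈ S ⊎ w ∈ hist
∈-ʳ++⁻ S hist w∈ with Any.reverseAcc⁻ hist S w∈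
... | inj₁ w∈hist = inj₂ w∈hist
... | inj₂ w∈S    = inj₁ w∈S

-- A history lists the vertices played so far, latest first, as the argument prev of LegalFrom.
module _ (G : Graph) where

  HasPrivateNeighbour : List (V G) → V G → Set
  HasPrivateNeighbour hist v = ∃ λ u → InN G v u × ¬ Dominated G hist u

  LegalHistory : List (V G) → Set
  LegalHistory []         = ⊤
  LegalHistory (v ∷ hist) = HasPrivateNeighbour hist v × LegalHistory hist

  legalFrom-ʳ++ : ∀ hist S → LegalHistory hist → LegalFrom G hist S → LegalFrom G [] (hist ʳ++ S)
  legalFrom-ʳ++ []         S _         legal = legal
  legalFrom-ʳ++ (v ∷ hist) S (pn , lh) legal = legalFrom-ʳ++ hist (v ∷ S) lh (pn , legal)

  legalHistory-ʳ++ : ∀ hist S → LegalFrom G hist S → LegalHistory hist → LegalHistory (S ʳ++ hist)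
  legalHistory-ʳ++ hist []      _            lh = lh
  legalHistory-ʳ++ hist (v ∷ S) (pn , legal) lh = legalHistory-ʳ++ (v ∷ hist) S legal (pn , lh)

  legalFrom-++ : ∀ hist S₁ S₂ → LegalFrom G hist S₁ → LegalFrom G (S₁ ʳ++ hist) S₂ →
                 LegalFrom G hist (S₁ ++ S₂)
  legalFrom-++ hist []       S₂ _             legal₂ = legal₂
  legalFrom-++ hist (v ∷ S₁) S₂ (pn , legal₁) legal₂ = pn , legalFrom-++ (v ∷ hist) S₁ S₂ legal₁ legal₂

  legalFrom-++⁻ : ∀ hist S₁ S₂ → LegalFrom G hist (S₁ ++ S₂) →
                  LegalFrom G hist S₁ × LegalFrom G (S₁ ʳ++ hist) S₂
  legalFrom-++⁻ hist []       S₂ legal        = tt , legal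
  legalFrom-++⁻ hist (v ∷ S₁) S₂ (pn , legal) =
    let legal₁ , legal₂ = legalFrom-++⁻ (v ∷ hist) S₁ S₂ legal in (pn , legal₁) , legal₂

  dominated-∷ : ∀ {hist u} v → Dominated G hist u → Dominated G (v ∷ hist) u
  dominated-∷ v (w , w∈ , wu) = w , there w∈ , wu

  -- a vertex x played earlier is dominated, so a later vertex with a private neighbour cannot be x
  legalFrom⇒fresh : ∀ {x} hist S → LegalFrom G hist S → x ∈ hist → All (λ y → ¬ x ≡ y) S
  legalFrom⇒fresh hist []      _                          _  = []
  legalFrom⇒fresh hist (v ∷ S) ((u , vu , undom) , legal) x∈ =
    (λ { refl → undom (_ , x∈ , vu) }) ∷ legalFrom⇒fresh (v ∷ hist) S legal (there x∈)

  legalFrom⇒Unique : ∀ hist S → LegalFrom G hist S → Unique S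
  legalFrom⇒Unique hist []      _            = []
  legalFrom⇒Unique hist (v ∷ S) (pn , legal) =
    legalFrom⇒fresh (v ∷ hist) S legal (here refl) ∷ legalFrom⇒Unique (v ∷ hist) S legal

  inN? : ∀ w u → Dec (InN G w u)
  inN? w u = _≟V_ G u w ⊎-dec T? (adj G w u)

  dominated? : ∀ hist u → Dec (Dominated G hist u)
  dominated? hist u = map′ find (λ (w , w∈ , wu) → lose w∈ wu) (any? (λ w → inN? w u) hist)

  extendToDominate : ∀ xs hist → LegalHistory hist →
    ∃ λ hist′ → LegalHistory hist′ × length hist ≤ length hist′ ×
                (∀ {u} → Dominated G hist u → Dominated G hist′ u) × All (Dominated G hist′) xs
  extendToDominate []       hist lh = hist , lh , ≤-refl , id , []
  extendToDominate (x ∷ xs) hist lh with dominated? hist x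
  ... | yes dom =
    let hist′ , lh′ , len , mono , doms = extendToDominate xs hist lh
    in  hist′ , lh′ , len , mono , mono dom ∷ doms
  ... | no undom =
    let hist′ , lh′ , len , mono , doms = extendToDominate xs (x ∷ hist) ((x , inj₁ refl , undom) , lh)
    in  hist′ , lh′ , ≤-trans (n≤1+n _) len , mono ∘ dominated-∷ x , mono (x , here refl , inj₁ refl) ∷ doms

  module _ (vertices : List (V G)) (∈-vertices : ∀ v → v ∈ vertices) where

    legalHistory⇒legalDominating : ∀ hist → LegalHistory hist →
                                   ∃ λ S → LegalDominating G S × length hist ≤ length S
    legalHistory⇒legalDominating hist lh =
      let hist′ , lh′ , len , _ , doms = extendToDominate vertices hist lh
          legal = legalFrom-ʳ++ hist′ [] lh′ tt
          dominating u = let w , w∈ , wu = All.lookup doms (∈-vertices u) in w , Any.reverse⁺ w∈ , wu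
      in  reverse hist′ , (legalFrom⇒Unique [] _ legal , legal , dominating) ,
          subst (length hist ≤_) (sym (length-reverse hist′)) len

    legalHistory-length≤ : ∀ {g} → IsGrundyDom G g → ∀ hist → LegalHistory hist → length hist ≤ g
    legalHistory-length≤ (_ , maximal) hist lh =
      let S , legalDom , len = legalHistory⇒legalDominating hist lh in ≤-trans len (maximal S legalDom)

  isGrundyDom-intro : ∀ N → (∀ S → LegalDominating G S → length S ≤ N) →
                      (∃ λ S → LegalDominating G S × N ≤ length S) → IsGrundyDom G N
  isGrundyDom-intro N maximal (S , legalDom , N≤) = (S , legalDom , ≤-antisym (maximal S legalDom) N≤) , maximal

sum< : ℕ → (ℕ → ℕ) → ℕ
sum< zero    f = 0
sum< (suc N) f = sum< N f + f N

sum<-mono : ∀ N {f g : ℕ → ℕ} → (∀ x → x < N → f x ≤ g x) → sum< N f ≤ sum< N g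
sum<-mono zero    f≤g = z≤n
sum<-mono (suc N) f≤g = +-mono-≤ (sum<-mono N (λ x x<N → f≤g x (m≤n⇒m≤1+n x<N))) (f≤g N ≤-refl)

sum<-+ : ∀ N {f g h : ℕ → ℕ} → (∀ x → x < N → f x + g x ≤ h x) → sum< N f + sum< N g ≤ sum< N h
sum<-+ zero    _ = z≤n
sum<-+ (suc N) {f} {g} f+g≤h =
  ≤-trans (≤-reflexive (interchange (sum< N f) (f N) (sum< N g) (g N)))
          (+-mono-≤ (sum<-+ N (λ x x<N → f+g≤h x (m≤n⇒m≤1+n x<N))) (f+g≤h N ≤-refl))
  where
  interchange : ∀ a b c d → a + b + (c + d) ≡ a + c + (b + d)
  interchange = solve-∀

sum<-bounded : ∀ N {f : ℕ → ℕ} {c} → (∀ x → x < N → f x ≤ c) → sum< N f ≤ N * c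
sum<-bounded zero    _   = z≤n
sum<-bounded (suc N) {c = c} f≤c =
  ≤-trans (+-mono-≤ (sum<-bounded N (λ x x<N → f≤c x (m≤n⇒m≤1+n x<N))) (f≤c N ≤-refl))
          (≤-reflexive (+-comm (N * c) c))

sum<-exchange : ∀ N {f f′ : ℕ → ℕ} j → j < N → (∀ x → x < N → ¬ x ≡ j → f′ x ≤ f x) →
                sum< N f′ + f j ≤ sum< N f + f′ j
sum<-exchange (suc N) {f} {f′} j j<1+N f′≤f with j ≟ N
... | yes refl =
  ≤-trans (≤-reflexive (rearrange (sum< N f′) (f′ N) (f N)))
          (≤-trans (+-monoˡ-≤ (f N + f′ N)
                      (sum<-mono N λ x x<N → f′≤f x (m≤n⇒m≤1+n x<N) λ { refl → <-irrefl refl x<N }))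
                   (≤-reflexive (sym (+-assoc (sum< N f) (f N) (f′ N)))))
  where
  rearrange : ∀ a b c → a + b + c ≡ a + (c + b)
  rearrange = solve-∀
... | no j≢N =
  ≤-trans (≤-reflexive (swap (sum< N f′) (f′ N) (f j)))
          (≤-trans (+-mono-≤ (sum<-exchange N j (≤∧≢⇒< (s≤s⁻¹ j<1+N) j≢N) (λ x x<N → f′≤f x (m≤n⇒m≤1+n x<N)))
                             (f′≤f N ≤-refl (j≢N ∘ sym)))
                   (≤-reflexive (swap (sum< N f) (f′ j) (f N))))
  where
  swap : ∀ a b c → a + b + c ≡ a + c + b
  swap = solve-∀

sum<-block : ∀ N {f : ℕ → ℕ} a c → a + c < N → (∀ x → a ≤ x → x ≤ a + c → 1 ≤ f x) → suc c ≤ sum< N f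
sum<-block (suc N) {f} a c a+c<1+N positive with a + c ≟ N
... | no a+c≢N =
  ≤-trans (sum<-block N a c (≤∧≢⇒< (s≤s⁻¹ a+c<1+N) a+c≢N) positive) (m≤m+n (sum< N f) (f N))
... | yes a+c≡N =
  ≤-trans (≤-reflexive (+-comm 1 c))
          (+-mono-≤ (initial c positive a+c≡N)
                    (positive N (≤-trans (m≤m+n a c) (≤-reflexive a+c≡N)) (≤-reflexive (sym a+c≡N))))
  where
  initial : ∀ c → (∀ x → a ≤ x → x ≤ a + c → 1 ≤ f x) → a + c ≡ N → c ≤ sum< N f
  initial zero     _        _     = z≤n
  initial (suc c′) positive a+c≡N =
    sum<-block N a c′ (≤-trans (≤-reflexive (sym (+-suc a c′))) (≤-reflexive a+c≡N))
               (λ x a≤x x≤ → positive x a≤x (≤-trans x≤ (+-monoʳ-≤ a (n≤1+n c′))))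

indicator : ∀ {A : Set} → Dec A → ℕ
indicator (yes _) = 1
indicator (no _)  = 0

indicator-yes : ∀ {A : Set} (a? : Dec A) → A → 1 ≤ indicator a?
indicator-yes (yes _) _ = ≤-refl
indicator-yes (no ¬a) a = ⊥-elim (¬a a)

indicator-no : ∀ {A : Set} (a? : Dec A) → ¬ A → indicator a? ≤ 0
indicator-no (yes a) ¬a = ⊥-elim (¬a a)
indicator-no (no _)  _  = z≤n

indicator≤1 : ∀ {A : Set} (a? : Dec A) → indicator a? ≤ 1
indicator≤1 (yes _) = ≤-refl
indicator≤1 (no _)  = z≤n

count< : ℕ → {P : ℕ → Set} → (∀ x → Dec (P x)) → ℕ
count< N P? = sum< N (indicator ∘ P?)

count<-block : ∀ N {P : ℕ → Set} (P? : ∀ x → Dec (P x)) a c → a + c < N →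
               (∀ x → a ≤ x → x ≤ a + c → P x) → suc c ≤ count< N P?
count<-block N P? a c a+c<N p = sum<-block N a c a+c<N (λ x a≤x x≤ → indicator-yes (P? x) (p x a≤x x≤))

count<-empty : ∀ N {P : ℕ → Set} (P? : ∀ x → Dec (P x)) → (∀ x → ¬ P x) → count< N P? ≡ 0
count<-empty N P? ¬p =
  n≤0⇒n≡0 (≤-trans (sum<-bounded N (λ x _ → indicator-no (P? x) (¬p x))) (≤-reflexive (*-zeroʳ N)))

count<-≤ : ∀ N {P : ℕ → Set} (P? : ∀ x → Dec (P x)) → count< N P? ≤ N
count<-≤ N P? = ≤-trans (sum<-bounded N (λ x _ → indicator≤1 (P? x))) (≤-reflexive (*-identityʳ N))

module _ {P Q : ℕ → Set} (P? : ∀ x → Dec (P x)) (Q? : ∀ x → Dec (Q x)) where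

  indicator-mono : ∀ x → (P x → Q x) → indicator (P? x) ≤ indicator (Q? x)
  indicator-mono x P⇒Q with P? x | Q? x
  ... | yes p | yes _ = ≤-refl
  ... | yes p | no ¬q = ⊥-elim (¬q (P⇒Q p))
  ... | no _  | _     = z≤n

  count<-mono : ∀ N → (∀ x → x < N → P x → Q x) → count< N P? ≤ count< N Q?
  count<-mono N P⇒Q = sum<-mono N (λ x x<N → indicator-mono x (P⇒Q x x<N))

  count<-grow : ∀ N a c → a + c < N → (∀ x → x < N → P x → Q x) →
                (∀ x → a ≤ x → x ≤ a + c → Q x × ¬ P x) → count< N P? + suc c ≤ count< N Q?
  count<-grow N a c a+c<N P⇒Q new =
    ≤-trans (+-monoʳ-≤ (count< N P?) (sum<-block N a c a+c<N (λ x a≤x x≤ → gain x (new x a≤x x≤))))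
            (sum<-+ N (λ x x<N → ≤-reflexive (m+[n∸m]≡n (indicator-mono x (P⇒Q x x<N)))))
    where
    gain : ∀ x → Q x × ¬ P x → 1 ≤ indicator (Q? x) ∸ indicator (P? x)
    gain x (q , ¬p) with P? x | Q? x
    ... | yes p | _     = ⊥-elim (¬p p)
    ... | no _  | yes _ = ≤-refl
    ... | no _  | no ¬q = ⊥-elim (¬q q)

  count<-grow₁ : ∀ N x → x < N → (∀ y → y < N → P y → Q y) → Q x → ¬ P x → count< N P? + 1 ≤ count< N Q?
  count<-grow₁ N x x<N P⇒Q qx ¬px =
    count<-grow N x 0 (subst (_< N) (sym (+-identityʳ x)) x<N) P⇒Q λ y x≤y y≤ →
      subst (λ z → Q z × ¬ P z) (≤-antisym x≤y (≤-trans y≤ (≤-reflexive (+-identityʳ x)))) (qx , ¬px)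

-- |a − b|, written as in the adjacency of pathPow so that it unfolds to the same term
dist : ℕ → ℕ → ℕ
dist a b = (a ∸ b) + (b ∸ a)

dist-refl : ∀ a → dist a a ≡ 0
dist-refl a rewrite n∸n≡0 a = refl

dist-self≤ : ∀ {m} a → dist a a ≤ m
dist-self≤ {m} a = subst (_≤ m) (sym (dist-refl a)) z≤n

dist≤⇒ : ∀ {m} a b → dist a b ≤ m → a ≤ b + m × b ≤ a + m
dist≤⇒ a b d≤m =
  ≤-trans (m≤n+m∸n a b) (+-monoʳ-≤ b (≤-trans (m≤m+n (a ∸ b) (b ∸ a)) d≤m)) ,
  ≤-trans (m≤n+m∸n b a) (+-monoʳ-≤ a (≤-trans (m≤n+m (b ∸ a) (a ∸ b)) d≤m))

≤⇒dist≤ : ∀ {m} a b → a ≤ b + m → b ≤ a + m → dist a b ≤ m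
≤⇒dist≤ a b a≤ b≤ with ≤-total a b
... | inj₁ a≤b rewrite m≤n⇒m∸n≡0 a≤b = m≤n+o⇒m∸n≤o b a b≤
... | inj₂ b≤a rewrite m≤n⇒m∸n≡0 b≤a | +-identityʳ (a ∸ b) = m≤n+o⇒m∸n≤o a b a≤

far⇒dist> : ∀ {m} a b → a + suc m ≤ b → m < dist a b
far⇒dist> {m} a b a+m<b =
  ≤-trans (m+n≤o⇒m≤o∸n (suc m) (≤-trans (≤-reflexive (+-comm (suc m) a)) a+m<b)) (m≤n+m (b ∸ a) (a ∸ b))

window-around : ∀ {m n} i → i < n → suc m ≤ n → ∃ λ a → a + m < n × (∀ y → a ≤ y → y ≤ a + m → dist i y ≤ m)
window-around {m} {suc n} i (s≤s i≤n) (s≤s m≤n) with i + m <? suc n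
... | yes i+m<1+n = i , i+m<1+n , λ y i≤y y≤ → ≤⇒dist≤ i y (≤-trans i≤y (m≤m+n y m)) y≤
... | no  i+m≮1+n = n ∸ m , s≤s (≤-reflexive a+m≡n) , λ y a≤y y≤ →
  ≤⇒dist≤ i y (≤-trans i≤n (≤-trans (≤-reflexive (sym a+m≡n)) (+-monoˡ-≤ m a≤y)))
              (≤-trans y≤ (≤-trans (≤-reflexive a+m≡n) (≤-trans (n≤1+n n) (≮⇒≥ i+m≮1+n))))
  where
  a+m≡n : n ∸ m + m ≡ n
  a+m≡n = m∸n+n≡m m≤n

T-does⁺ : ∀ {A : Set} (a? : Dec A) → A → T (does a?)
T-does⁺ (yes _) _ = tt
T-does⁺ (no ¬a) a = ¬a a

T-does⁻ : ∀ {A : Set} (a? : Dec A) → T (does a?) → A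
T-does⁻ (yes a) _ = a

T-not-does⁺ : ∀ {A : Set} (a? : Dec A) → ¬ A → T (not (does a?))
T-not-does⁺ (yes a) ¬a = ¬a a
T-not-does⁺ (no _)  _  = tt

T-not-does⁻ : ∀ {A : Set} (a? : Dec A) → T (not (does a?)) → ¬ A
T-not-does⁻ (no ¬a) _ = ¬a

module LexNeighbourhood (m n k : ℕ) (H : SimpleGraph k) where

  HG : Graph
  HG = toGraph H

  G : Graph
  G = lex (pathPow n m) HG

  Vertex : Set
  Vertex = Fin n × Fin k

  vertices : List Vertex
  vertices = cartesianProduct (allFin n) (allFin k)

  ∈-vertices : ∀ v → v ∈ vertices
  ∈-vertices (i , h) = ∈-cartesianProduct⁺ (∈-allFin i) (∈-allFin h)

  layerOf : Vertex → ℕ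
  layerOf = toℕ ∘ proj₁

  InN-lex⁻ : ∀ j y i x → InN G (j , y) (i , x) →
             (¬ toℕ j ≡ toℕ i × dist (toℕ j) (toℕ i) ≤ m) ⊎ (j ≡ i × InN HG y x)
  InN-lex⁻ j y i x (inj₁ refl) = inj₂ (refl , inj₁ refl)
  InN-lex⁻ j y i x (inj₂ adjacent) with Equivalence.to T-∨ adjacent
  ... | inj₁ pathAdj = let j≢i , close = Equivalence.to T-∧ pathAdj
                       in  inj₁ (T-not-does⁻ (toℕ j ≟ toℕ i) j≢i , ≤ᵇ⇒≤ _ _ close)
  ... | inj₂ layerAdj = let j≡i , yx = Equivalence.to T-∧ layerAdj
                        in  inj₂ (T-does⁻ (j Fin.≟ i) j≡i , inj₂ yx)

  InN-lex-across : ∀ j y i x → ¬ toℕ j ≡ toℕ i → dist (toℕ j) (toℕ i) ≤ m → InN G (j , y) (i , x)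
  InN-lex-across j y i x j≢i close =
    inj₂ (Equivalence.from T-∨ (inj₁ (Equivalence.from T-∧ (T-not-does⁺ (toℕ j ≟ toℕ i) j≢i , ≤⇒≤ᵇ close))))

  InN-lex-within : ∀ i y x → InN HG y x → InN G (i , y) (i , x)
  InN-lex-within i y x (inj₁ refl) = inj₁ refl
  InN-lex-within i y x (inj₂ yx)   =
    inj₂ (Equivalence.from T-∨ (inj₂ (Equivalence.from T-∧ (T-does⁺ (i Fin.≟ i) refl , yx))))

  ¬InN-lex-far : ∀ j y i x → m < dist (toℕ j) (toℕ i) → ¬ InN G (j , y) (i , x)
  ¬InN-lex-far j y i x far jy→ix with InN-lex⁻ j y i x jy→ix
  ... | inj₁ (_ , close) = <⇒≱ far close
  ... | inj₂ (refl , _) rewrite dist-refl (toℕ j) = <⇒≱ far z≤n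

exchange⇒drop : ∀ {t t′ b b′} → t′ + b ≤ t + b′ → suc b′ ≤ b → suc t′ ≤ t
exchange⇒drop {t} {t′} {b} {b′} exchange b′<b =
  +-cancelʳ-≤ b′ (suc t′) t (≤-trans (≤-reflexive (sym (+-suc t′ b′))) (≤-trans (+-monoʳ-≤ t′ b′<b) exchange))

+-suc-≤ : ∀ {a t t′ X} → a + t ≤ X → suc t′ ≤ t → suc a + t′ ≤ X
+-suc-≤ {a} {t} {t′} a+t≤X t′<t = ≤-trans (≤-reflexive (sym (+-suc a t′))) (≤-trans (+-monoʳ-≤ a t′<t) a+t≤X)

+1-≤ : ∀ {a c c′} e → a + e ≤ c → c + 1 ≤ c′ → a + suc e ≤ c′
+1-≤ {a} e a+e≤c c+1≤c′ =
  ≤-trans (≤-reflexive (trans (+-suc a e) (+-comm 1 (a + e)))) (≤-trans (+-monoˡ-≤ 1 a+e≤c) c+1≤c′)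

module UpperBound (m n k : ℕ) (H : SimpleGraph k) (g : ℕ)
                  (legalH≤g : ∀ hist → LegalHistory (toGraph H) hist → length hist ≤ g)
                  (1+m≤n : suc m ≤ n) where

  open LexNeighbourhood m n k H

  layer : ℕ → List Vertex → List (Fin k)
  layer s hist = map proj₂ (filter (λ v → layerOf v ≟ s) hist)

  layer-here : ∀ s v hist → layerOf v ≡ s → layer s (v ∷ hist) ≡ proj₂ v ∷ layer s hist
  layer-here s v hist eq = cong (map proj₂) (filter-accept (λ w → layerOf w ≟ s) eq)

  layer-there : ∀ s v hist → ¬ layerOf v ≡ s → layer s (v ∷ hist) ≡ layer s hist
  layer-there s v hist neq = cong (map proj₂) (filter-reject (λ w → layerOf w ≟ s) neq)

  ∈-layer⁻ : ∀ s hist {y} → y ∈ layer s hist → ∃ λ j → (j , y) ∈ hist × toℕ j ≡ s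
  ∈-layer⁻ s hist y∈ with ∈-map⁻ proj₂ y∈
  ... | (j , _) , v∈ , refl = j , ∈-filter⁻ (λ w → layerOf w ≟ s) {xs = hist} v∈

  Touched : ℕ → List Vertex → Set
  Touched s = Any (λ v → layerOf v ≡ s)

  -- a vertex of another layer dominates all of layer s
  External : ℕ → List Vertex → Set
  External s = Any (λ v → ¬ layerOf v ≡ s × dist (layerOf v) s ≤ m)

  Near : ℕ → List Vertex → Set
  Near s = Any (λ v → dist (layerOf v) s ≤ m)

  Covers : ℕ → List Vertex → Set
  Covers x = Any (λ v → layerOf v ≤ x × x ≤ layerOf v + m)

  touched? : ∀ s hist → Dec (Touched s hist)
  touched? s = any? (λ v → layerOf v ≟ s)

  external? : ∀ s hist → Dec (External s hist)
  external? s = any? (λ v → ¬? (layerOf v ≟ s) ×-dec (dist (layerOf v) s ≤? m))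

  near? : ∀ s hist → Dec (Near s hist)
  near? s = any? (λ v → dist (layerOf v) s ≤? m)

  covers? : ∀ x hist → Dec (Covers x hist)
  covers? x = any? (λ v → (layerOf v ≤? x) ×-dec (x ≤? layerOf v + m))

  layer-untouched : ∀ s hist → ¬ Touched s hist → layer s hist ≡ []
  layer-untouched s hist ¬t = cong (map proj₂) (filter-none (λ w → layerOf w ≟ s) (¬Any⇒All¬ hist ¬t))

  touched⇒near : ∀ s hist → Touched s hist → Near s hist
  touched⇒near s hist t with find t
  ... | v , v∈ , refl = lose v∈ (dist-self≤ (layerOf v))

  near∧¬touched⇒external : ∀ s hist → Near s hist → ¬ Touched s hist → External s hist
  near∧¬touched⇒external s hist near ¬t = let v , v∈ , close = find near in lose v∈ ((¬t ∘ lose v∈) , close)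

  near∧¬external⇒touched : ∀ s hist → Near s hist → ¬ External s hist → Touched s hist
  near∧¬external⇒touched s hist near ¬ext with find near
  ... | v , v∈ , close with layerOf v ≟ s
  ...   | yes eq  = lose v∈ eq
  ...   | no  neq = ⊥-elim (¬ext (lose v∈ (neq , close)))

  -- the number of further vertices layer s can absorb while no other layer dominates it
  budget : ℕ → List Vertex → ℕ
  budget s hist with external? s hist | touched? s hist
  ... | yes _ | _     = 0
  ... | no _  | no _  = 0
  ... | no _  | yes _ = g ∸ length (layer s hist)

  totalBudget : List Vertex → ℕ
  totalBudget hist = sum< n (λ s → budget s hist)

  coverCount : List Vertex → ℕ
  coverCount hist = count< (n + m) (λ x → covers? x hist)

  nearCount : List Vertex → ℕ
  nearCount hist = count< n (λ s → near? s hist)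

  budget-external : ∀ s hist → External s hist → budget s hist ≡ 0
  budget-external s hist ext with external? s hist
  ... | yes _   = refl
  ... | no ¬ext = ⊥-elim (¬ext ext)

  budget-untouched : ∀ s hist → ¬ Touched s hist → budget s hist ≡ 0
  budget-untouched s hist ¬t with external? s hist | touched? s hist
  ... | yes _ | _     = refl
  ... | no _  | no _  = refl
  ... | no _  | yes t = ⊥-elim (¬t t)

  budget-open : ∀ s hist → Touched s hist → ¬ External s hist → budget s hist ≡ g ∸ length (layer s hist)
  budget-open s hist t ¬ext with external? s hist | touched? s hist
  ... | yes ext | _     = ⊥-elim (¬ext ext)
  ... | no _    | no ¬t = ⊥-elim (¬t t)
  ... | no _    | yes _ = refl

  budget≤ : ∀ s hist → budget s hist ≤ g ∸ length (layer s hist)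
  budget≤ s hist with external? s hist | touched? s hist
  ... | yes _ | _     = z≤n
  ... | no _  | no _  = z≤n
  ... | no _  | yes _ = ≤-refl

  budget-∷-other : ∀ s v hist → ¬ layerOf v ≡ s → budget s (v ∷ hist) ≤ budget s hist
  budget-∷-other s v hist neq with external? s (v ∷ hist) | touched? s (v ∷ hist)
  ... | yes _    | _             = z≤n
  ... | no _     | no _          = z≤n
  ... | no _     | yes (here eq) = ⊥-elim (neq eq)
  ... | no ¬ext′ | yes (there t) = ≤-reflexive (begin
    g ∸ length (layer s (v ∷ hist)) ≡⟨ cong (λ l → g ∸ length l) (layer-there s v hist neq) ⟩
    g ∸ length (layer s hist)       ≡⟨ budget-open s hist t (¬ext′ ∘ there) ⟨
    budget s hist                   ∎)
    where open ≡-Reasoning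

  totalBudget-exchange : ∀ j v hist → j < n → (∀ s → ¬ s ≡ j → budget s (v ∷ hist) ≤ budget s hist) →
                         totalBudget (v ∷ hist) + budget j hist ≤ totalBudget hist + budget j (v ∷ hist)
  totalBudget-exchange j v hist j<n lower = sum<-exchange n j j<n (λ s _ → lower s)

  totalBudget-∷ : ∀ v hist →
                  totalBudget (v ∷ hist) + budget (layerOf v) hist ≤ totalBudget hist + budget (layerOf v) (v ∷ hist)
  totalBudget-∷ v hist =
    totalBudget-exchange (layerOf v) v hist (Fin.toℕ<n (proj₁ v)) (λ s s≢ → budget-∷-other s v hist (s≢ ∘ sym))

  coverCount-mono : ∀ v hist → coverCount hist ≤ coverCount (v ∷ hist)
  coverCount-mono v hist = count<-mono (λ x → covers? x hist) (λ x → covers? x (v ∷ hist)) (n + m) (λ _ _ → there)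

  coverCount-grow : ∀ v hist a c → a + c < n + m → (∀ x → a ≤ x → x ≤ a + c → Covers x (v ∷ hist) × ¬ Covers x hist) →
                    coverCount hist + suc c ≤ coverCount (v ∷ hist)
  coverCount-grow v hist a c a+c<n+m =
    count<-grow (λ x → covers? x hist) (λ x → covers? x (v ∷ hist)) (n + m) a c a+c<n+m (λ _ _ → there)

  coverCount-grow₁ : ∀ v hist x → x < n + m → Covers x (v ∷ hist) → ¬ Covers x hist →
                     coverCount hist + 1 ≤ coverCount (v ∷ hist)
  coverCount-grow₁ v hist x x<n+m =
    count<-grow₁ (λ x → covers? x hist) (λ x → covers? x (v ∷ hist)) (n + m) x x<n+m (λ _ _ → there)

  nearCount-mono : ∀ v hist → nearCount hist ≤ nearCount (v ∷ hist)
  nearCount-mono v hist = count<-mono (λ s → near? s hist) (λ s → near? s (v ∷ hist)) n (λ _ _ → there)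

  nearCount-grow₁ : ∀ v hist s → s < n → Near s (v ∷ hist) → ¬ Near s hist → nearCount hist + 1 ≤ nearCount (v ∷ hist)
  nearCount-grow₁ v hist s s<n =
    count<-grow₁ (λ s → near? s hist) (λ s → near? s (v ∷ hist)) n s s<n (λ _ _ → there)

  nearCount-single : ∀ v → suc m ≤ nearCount (v ∷ [])
  nearCount-single v =
    let a , a+m<n , close = window-around (layerOf v) (Fin.toℕ<n (proj₁ v)) 1+m≤n
    in  count<-block n (λ s → near? s (v ∷ [])) a m a+m<n (λ s a≤s s≤ → here (close s a≤s s≤))

  coverCount-[] : coverCount [] ≡ 0
  coverCount-[] = count<-empty (n + m) (λ x → covers? x []) (λ _ ())

  totalBudget-[] : totalBudget [] ≡ 0
  totalBudget-[] = n≤0⇒n≡0 (≤-trans (sum<-bounded n (λ _ _ → z≤n)) (≤-reflexive (*-zeroʳ n)))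

  LayersLegal : List Vertex → Set
  LayersLegal hist = ∀ s → LegalHistory HG (layer s hist)

  layersLegal-∷ : ∀ hist i h → LayersLegal hist → HasPrivateNeighbour HG (layer (toℕ i) hist) h →
                  LayersLegal ((i , h) ∷ hist)
  layersLegal-∷ hist i h legal pn s with toℕ i ≟ s
  ... | yes refl = subst (LegalHistory HG) (sym (layer-here s (i , h) hist refl)) (pn , legal s)
  ... | no  i≢s  = subst (LegalHistory HG) (sym (layer-there s (i , h) hist i≢s)) (legal s)

  layersLegal-∷-untouched : ∀ hist i h → LayersLegal hist → ¬ Touched (toℕ i) hist → LayersLegal ((i , h) ∷ hist)
  layersLegal-∷-untouched hist i h legal ¬t =
    layersLegal-∷ hist i h legal (subst (λ l → HasPrivateNeighbour HG l h) (sym (layer-untouched (toℕ i) hist ¬t))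
                                        (h , inj₁ refl , λ { (_ , () , _) }))

  undominated⇒¬external : ∀ hist ℓ x → ¬ Dominated G hist (ℓ , x) → ¬ External (toℕ ℓ) hist
  undominated⇒¬external hist ℓ x undom ext =
    let (j , y) , w∈ , j≢ℓ , close = find ext in undom ((j , y) , w∈ , InN-lex-across j y ℓ x j≢ℓ close)

  undominated⇒undominatedInLayer : ∀ hist ℓ x → ¬ Dominated G hist (ℓ , x) → ¬ Dominated HG (layer (toℕ ℓ) hist) x
  undominated⇒undominatedInLayer hist ℓ x undom (y , y∈ , yx) with ∈-layer⁻ (toℕ ℓ) hist y∈
  ... | j , jy∈ , eq with Fin.toℕ-injective eq
  ...   | refl = undom ((j , y) , jy∈ , InN-lex-within j y x yx)

  -- if (ℓ , x) is undominated, x itself extends the legal sequence of H played in layer ℓ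
  layerSize<g : ∀ hist ℓ x → LayersLegal hist → ¬ Dominated G hist (ℓ , x) → suc (length (layer (toℕ ℓ) hist)) ≤ g
  layerSize<g hist ℓ x legal undom =
    legalH≤g (x ∷ layer (toℕ ℓ) hist) ((x , inj₁ refl , undominated⇒undominatedInLayer hist ℓ x undom) , legal (toℕ ℓ))

  totalBudget-fresh : ∀ hist i h → ¬ Touched (toℕ i) hist → totalBudget ((i , h) ∷ hist) ≤ totalBudget hist + (g ∸ 1)
  totalBudget-fresh hist i h ¬t =
    ≤-trans (≤-reflexive (sym (+-identityʳ _)))
            (subst (λ b → totalBudget ((i , h) ∷ hist) + b ≤ totalBudget hist + (g ∸ 1))
                   (budget-untouched (toℕ i) hist ¬t)
                   (≤-trans (totalBudget-∷ (i , h) hist) (+-monoʳ-≤ (totalBudget hist) budgetᵢ≤)))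
    where
    budgetᵢ≤ : budget (toℕ i) ((i , h) ∷ hist) ≤ g ∸ 1
    budgetᵢ≤ = subst (λ l → budget (toℕ i) ((i , h) ∷ hist) ≤ g ∸ length l)
                     (trans (layer-here (toℕ i) (i , h) hist refl) (cong (h ∷_) (layer-untouched (toℕ i) hist ¬t)))
                     (budget≤ (toℕ i) ((i , h) ∷ hist))

  totalBudget-withinLayer : ∀ hist i h x → LayersLegal hist → Touched (toℕ i) hist → ¬ Dominated G hist (i , x) →
                            suc (totalBudget ((i , h) ∷ hist)) ≤ totalBudget hist
  totalBudget-withinLayer hist i h x legal t undom =
    exchange⇒drop (subst₂ (λ b b′ → totalBudget ((i , h) ∷ hist) + b ≤ totalBudget hist + b′)
                          before after (totalBudget-∷ (i , h) hist)) ≤-refl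
    where
    c : ℕ
    c = length (layer (toℕ i) hist)
    ¬external : ¬ External (toℕ i) hist
    ¬external = undominated⇒¬external hist i x undom
    before : budget (toℕ i) hist ≡ suc (g ∸ suc c)
    before = trans (budget-open (toℕ i) hist t ¬external) (+-∸-assoc 1 (layerSize<g hist i x legal undom))
    after : budget (toℕ i) ((i , h) ∷ hist) ≡ g ∸ suc c
    after = trans (budget-open (toℕ i) ((i , h) ∷ hist) (here refl)
                               λ { (here (i≢i , _)) → i≢i refl ; (there ext) → ¬external ext })
                  (cong (λ l → g ∸ length l) (layer-here (toℕ i) (i , h) hist refl))

  totalBudget-acrossFresh : ∀ hist i h → ¬ Touched (toℕ i) hist → External (toℕ i) hist →
                            totalBudget ((i , h) ∷ hist) ≤ totalBudget hist
  totalBudget-acrossFresh hist i h ¬t ext =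
    +-cancelʳ-≤ 0 _ _ (subst₂ (λ b b′ → totalBudget ((i , h) ∷ hist) + b ≤ totalBudget hist + b′)
                              (budget-untouched (toℕ i) hist ¬t) (budget-external (toℕ i) ((i , h) ∷ hist) (there ext))
                              (totalBudget-∷ (i , h) hist))

  -- the vertex closes layer ℓ, whose budget was positive, and takes nothing from the already closed layer i
  totalBudget-acrossCharged : ∀ hist i h ℓ x → LayersLegal hist → External (toℕ i) hist →
                              ¬ toℕ i ≡ toℕ ℓ → dist (toℕ i) (toℕ ℓ) ≤ m → Near (toℕ ℓ) hist →
                              ¬ Dominated G hist (ℓ , x) → suc (totalBudget ((i , h) ∷ hist)) ≤ totalBudget hist
  totalBudget-acrossCharged hist i h ℓ x legal ext i≢ℓ close nearℓ undom =
    exchange⇒drop (subst (λ b′ → totalBudget ((i , h) ∷ hist) + budget (toℕ ℓ) hist ≤ totalBudget hist + b′)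
                         (budget-external (toℕ ℓ) ((i , h) ∷ hist) (here (i≢ℓ , close)))
                         (totalBudget-exchange (toℕ ℓ) (i , h) hist (Fin.toℕ<n ℓ) (λ s _ → othersKept s (toℕ i ≟ s))))
                  budgetℓ≥1
    where
    ¬externalℓ : ¬ External (toℕ ℓ) hist
    ¬externalℓ = undominated⇒¬external hist ℓ x undom
    budgetℓ≥1 : 1 ≤ budget (toℕ ℓ) hist
    budgetℓ≥1 = subst (1 ≤_) (sym (budget-open (toℕ ℓ) hist touchedℓ ¬externalℓ))
                      (m<n⇒0<n∸m (layerSize<g hist ℓ x legal undom))
      where
      touchedℓ : Touched (toℕ ℓ) hist
      touchedℓ = near∧¬external⇒touched (toℕ ℓ) hist nearℓ ¬externalℓ
    othersKept : ∀ s → Dec (toℕ i ≡ s) → budget s ((i , h) ∷ hist) ≤ budget s hist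
    othersKept s (yes refl) = ≤-trans (≤-reflexive (budget-external (toℕ i) ((i , h) ∷ hist) (there ext))) z≤n
    othersKept s (no  i≢s)  = budget-∷-other s (i , h) hist i≢s

  uncovered-far : ∀ hist s y → ¬ Near s hist → (∀ {a} → a ≤ y → y ≤ a + m → dist a s ≤ m) → ¬ Covers y hist
  uncovered-far hist s y far closeTo covered =
    let w , w∈ , w≤y , y≤w+m = find covered in far (lose w∈ (closeTo w≤y y≤w+m))

  coverCount-fresh : ∀ hist i h → ¬ Near (toℕ i) hist → coverCount hist + suc m ≤ coverCount ((i , h) ∷ hist)
  coverCount-fresh hist i h far = coverCount-grow (i , h) hist (toℕ i) m (+-monoˡ-< m (Fin.toℕ<n i)) λ x i≤x x≤ →
    here (i≤x , x≤) ,
    uncovered-far hist (toℕ i) x far λ {a} a≤x x≤a+m → ≤⇒dist≤ a (toℕ i) (≤-trans a≤x x≤) (≤-trans i≤x x≤a+m)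

  -- the interval [i, i + m] reaches ℓ or ℓ + m, which no earlier interval reaches
  coverCount-acrossFresh : ∀ hist i h ℓ → dist (toℕ i) (toℕ ℓ) ≤ m → ¬ Near (toℕ ℓ) hist →
                           coverCount hist + 1 ≤ coverCount ((i , h) ∷ hist)
  coverCount-acrossFresh hist i h ℓ close farℓ with toℕ i ≤? toℕ ℓ
  ... | yes i≤ℓ =
    coverCount-grow₁ (i , h) hist (toℕ ℓ) (≤-trans (Fin.toℕ<n ℓ) (m≤m+n n m))
      (here (i≤ℓ , proj₂ (dist≤⇒ (toℕ i) (toℕ ℓ) close)))
      (uncovered-far hist (toℕ ℓ) (toℕ ℓ) farℓ λ {a} a≤ℓ ℓ≤a+m →
        ≤⇒dist≤ a (toℕ ℓ) (≤-trans a≤ℓ (m≤m+n (toℕ ℓ) m)) ℓ≤a+m)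
  ... | no  i≰ℓ =
    coverCount-grow₁ (i , h) hist (toℕ ℓ + m) (+-monoˡ-< m (Fin.toℕ<n ℓ))
      (here (proj₁ (dist≤⇒ (toℕ i) (toℕ ℓ) close) , +-monoˡ-≤ m (<⇒≤ (≰⇒> i≰ℓ))))
      (uncovered-far hist (toℕ ℓ) (toℕ ℓ + m) farℓ λ {a} a≤ℓ+m ℓ+m≤a+m →
        ≤⇒dist≤ a (toℕ ℓ) a≤ℓ+m (≤-trans (+-cancelʳ-≤ m (toℕ ℓ) a ℓ+m≤a+m) (m≤m+n a m)))

  g≥1 : Fin k → 1 ≤ g
  g≥1 h = legalH≤g (h ∷ []) ((h , inj₁ refl , λ { (_ , () , _) }) , tt)

  -- p counts the vertices played more than m layers away from all earlier ones, e the vertices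
  -- whose private neighbour lies in a layer that no earlier vertex was within m layers of
  record Invariant (hist : List Vertex) (p e : ℕ) : Set where
    field
      layersLegal    : LayersLegal hist
      lengthBound    : length hist + totalBudget hist ≤ p * g + e
      coverBound     : suc m * p + e ≤ coverCount hist
      nearBound      : 1 ≤ p → m + p + e ≤ nearCount hist
      emptyIfNoFresh : p ≡ 0 → hist ≡ []
  open Invariant

  any⇒nonempty : ∀ {P : Vertex → Set} {hist} → Any P hist → ¬ hist ≡ []
  any⇒nonempty any refl = Any.¬Any[] any

  lengthBound-fresh : ∀ {len t t′} p e → 1 ≤ g → len + t ≤ p * g + e → t′ ≤ t + (g ∸ 1) →
                      suc len + t′ ≤ suc p * g + e
  lengthBound-fresh {len} {t} {t′} p e 1≤g bound t′≤ = begin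
    suc len + t′                ≤⟨ +-monoʳ-≤ (suc len) t′≤ ⟩
    suc len + (t + (g ∸ 1))     ≡⟨ regroup len t (g ∸ 1) ⟩
    len + t + (g ∸ 1 + 1)       ≤⟨ +-mono-≤ bound (≤-reflexive (m∸n+n≡m 1≤g)) ⟩
    p * g + e + g               ≡⟨ shuffle p g e ⟩
    suc p * g + e               ∎
    where
    open ≤-Reasoning
    regroup : ∀ a b c → suc a + (b + c) ≡ a + b + (c + 1)
    regroup = solve-∀
    shuffle : ∀ p g e → p * g + e + g ≡ suc p * g + e
    shuffle = solve-∀

  nearBound-fresh : ∀ {hist} p e i h → ¬ Near (toℕ i) hist → (p ≡ 0 → hist ≡ []) → suc m * p + e ≤ coverCount hist →
                    (1 ≤ p → m + p + e ≤ nearCount hist) → m + suc p + e ≤ nearCount ((i , h) ∷ hist)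
  nearBound-fresh zero e i h far empty cover _ with refl ← empty refl =
    subst (_≤ nearCount ((i , h) ∷ [])) (sym (trans (cong (m + 1 +_) e≡0) (trans (+-identityʳ (m + 1)) (+-comm m 1))))
          (nearCount-single (i , h))
    where
    e≡0 : e ≡ 0
    e≡0 = n≤0⇒n≡0 (≤-trans (m≤n+m e (suc m * 0)) (≤-trans cover (≤-reflexive coverCount-[])))
  nearBound-fresh {hist} (suc p) e i h far _ _ near =
    subst (_≤ nearCount ((i , h) ∷ hist)) (sym (oneMore m p e))
          (≤-trans (+-monoˡ-≤ 1 (near (s≤s z≤n)))
                   (nearCount-grow₁ (i , h) hist (toℕ i) (Fin.toℕ<n i) (here (dist-self≤ (toℕ i))) far))
    where
    oneMore : ∀ m p e → m + suc (suc p) + e ≡ m + suc p + e + 1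
    oneMore = solve-∀

  step-fresh : ∀ {hist p e} i h → Invariant hist p e → ¬ Near (toℕ i) hist → Invariant ((i , h) ∷ hist) (suc p) e
  step-fresh {hist} {p} {e} i h inv far = record
    { layersLegal    = layersLegal-∷-untouched hist i h (layersLegal inv) untouched
    ; lengthBound    = lengthBound-fresh p e (g≥1 h) (lengthBound inv) (totalBudget-fresh hist i h untouched)
    ; coverBound     = subst (_≤ coverCount ((i , h) ∷ hist)) (sym (newCost m p e))
                         (≤-trans (+-monoˡ-≤ (suc m) (coverBound inv)) (coverCount-fresh hist i h far))
    ; nearBound      = λ _ → nearBound-fresh p e i h far (emptyIfNoFresh inv) (coverBound inv) (nearBound inv)
    ; emptyIfNoFresh = λ ()
    }
    where
    untouched : ¬ Touched (toℕ i) hist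
    untouched = far ∘ touched⇒near (toℕ i) hist
    newCost : ∀ m p e → suc m * suc p + e ≡ suc m * p + e + suc m
    newCost = solve-∀

  step-withinLayer : ∀ {hist p e} i h → Invariant hist p e → Touched (toℕ i) hist →
                     HasPrivateNeighbour G hist (i , h) → Invariant ((i , h) ∷ hist) p e
  step-withinLayer {hist} i h inv t ((ℓ , x) , hx , undom) with InN-lex⁻ i h ℓ x hx
  ... | inj₁ (i≢ℓ , close) =
    -- the earlier vertex in layer i dominates (ℓ , x) just as (i , h) does
    let (j , y) , w∈ , j≡i = find t
    in  ⊥-elim (undom ((j , y) , w∈ , InN-lex-across j y ℓ x (λ j≡ℓ → i≢ℓ (trans (sym j≡i) j≡ℓ))
                                                         (subst (λ z → dist z (toℕ ℓ) ≤ m) (sym j≡i) close)))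
  ... | inj₂ (refl , hx′) = record
    { layersLegal    = layersLegal-∷ hist i h (layersLegal inv)
                         (x , hx′ , undominated⇒undominatedInLayer hist i x undom)
    ; lengthBound    = +-suc-≤ (lengthBound inv) (totalBudget-withinLayer hist i h x (layersLegal inv) t undom)
    ; coverBound     = ≤-trans (coverBound inv) (coverCount-mono (i , h) hist)
    ; nearBound      = λ 1≤p → ≤-trans (nearBound inv 1≤p) (nearCount-mono (i , h) hist)
    ; emptyIfNoFresh = λ p≡0 → ⊥-elim (any⇒nonempty t (emptyIfNoFresh inv p≡0))
    }

  step-acrossFresh : ∀ {hist p e} i h ℓ → Invariant hist p e → ¬ Touched (toℕ i) hist → External (toℕ i) hist →
                     dist (toℕ i) (toℕ ℓ) ≤ m → ¬ Near (toℕ ℓ) hist → Invariant ((i , h) ∷ hist) p (suc e)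
  step-acrossFresh {hist} {p} {e} i h ℓ inv ¬t ext close farℓ = record
    { layersLegal    = layersLegal-∷-untouched hist i h (layersLegal inv) ¬t
    ; lengthBound    = subst (suc (length hist) + totalBudget ((i , h) ∷ hist) ≤_) (sym (+-suc (p * g) e))
                         (s≤s (≤-trans (+-monoʳ-≤ (length hist) (totalBudget-acrossFresh hist i h ¬t ext))
                                       (lengthBound inv)))
    ; coverBound     = +1-≤ e (coverBound inv) (coverCount-acrossFresh hist i h ℓ close farℓ)
    ; nearBound      = λ 1≤p → +1-≤ e (nearBound inv 1≤p)
                                 (nearCount-grow₁ (i , h) hist (toℕ ℓ) (Fin.toℕ<n ℓ) (here close) farℓ)
    ; emptyIfNoFresh = λ p≡0 → ⊥-elim (any⇒nonempty ext (emptyIfNoFresh inv p≡0))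
    }

  step-acrossCharged : ∀ {hist p e} i h ℓ x → Invariant hist p e → ¬ Touched (toℕ i) hist → External (toℕ i) hist →
                       ¬ toℕ i ≡ toℕ ℓ → dist (toℕ i) (toℕ ℓ) ≤ m → Near (toℕ ℓ) hist → ¬ Dominated G hist (ℓ , x) →
                       Invariant ((i , h) ∷ hist) p e
  step-acrossCharged {hist} i h ℓ x inv ¬t ext i≢ℓ close nearℓ undom = record
    { layersLegal    = layersLegal-∷-untouched hist i h (layersLegal inv) ¬t
    ; lengthBound    = +-suc-≤ (lengthBound inv)
                               (totalBudget-acrossCharged hist i h ℓ x (layersLegal inv) ext i≢ℓ close nearℓ undom)
    ; coverBound     = ≤-trans (coverBound inv) (coverCount-mono (i , h) hist)
    ; nearBound      = λ 1≤p → ≤-trans (nearBound inv 1≤p) (nearCount-mono (i , h) hist)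
    ; emptyIfNoFresh = λ p≡0 → ⊥-elim (any⇒nonempty ext (emptyIfNoFresh inv p≡0))
    }

  step-across : ∀ {hist p e} i h → Invariant hist p e → External (toℕ i) hist → ¬ Touched (toℕ i) hist →
                HasPrivateNeighbour G hist (i , h) → ∃₂ λ p′ e′ → Invariant ((i , h) ∷ hist) p′ e′
  step-across {hist} i h inv ext ¬t ((ℓ , x) , hx , undom) with InN-lex⁻ i h ℓ x hx | near? (toℕ ℓ) hist
  ... | inj₂ (refl , _)    | _         = ⊥-elim (undominated⇒¬external hist i x undom ext)
  ... | inj₁ (i≢ℓ , close) | no  farℓ  = _ , _ , step-acrossFresh i h ℓ inv ¬t ext close farℓ
  ... | inj₁ (i≢ℓ , close) | yes nearℓ = _ , _ , step-acrossCharged i h ℓ x inv ¬t ext i≢ℓ close nearℓ undom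

  step : ∀ {hist p e} → Invariant hist p e → ∀ v → HasPrivateNeighbour G hist v →
         ∃₂ λ p′ e′ → Invariant (v ∷ hist) p′ e′
  step {hist} inv (i , h) pn with near? (toℕ i) hist | touched? (toℕ i) hist
  ... | no  far  | _     = _ , _ , step-fresh i h inv far
  ... | yes _    | yes t = _ , _ , step-withinLayer i h inv t pn
  ... | yes near | no ¬t = step-across i h inv (near∧¬touched⇒external (toℕ i) hist near ¬t) ¬t pn

  invariant-[] : Invariant [] 0 0
  invariant-[] = record
    { layersLegal    = λ _ → tt
    ; lengthBound    = ≤-reflexive totalBudget-[]
    ; coverBound     = ≤-trans (≤-reflexive (trans (+-identityʳ (suc m * 0)) (*-zeroʳ (suc m)))) z≤n
    ; nearBound      = λ ()
    ; emptyIfNoFresh = λ _ → refl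
    }

  invariant-ʳ++ : ∀ {hist p e} S → Invariant hist p e → LegalFrom G hist S → ∃₂ λ p′ e′ → Invariant (S ʳ++ hist) p′ e′
  invariant-ʳ++ []      inv _            = _ , _ , inv
  invariant-ʳ++ (v ∷ S) inv (pn , legal) = let _ , _ , inv′ = step inv v pn in invariant-ʳ++ S inv′ legal

  Accounting : ℕ → Set
  Accounting L = ∃₂ λ p e → L ≤ p * g + e × suc m * p + e ≤ n + m × (1 ≤ p → m + p + e ≤ n) × (p ≡ 0 → L ≡ 0)

  upperBound : ∀ S → LegalFrom G [] S → Accounting (length S)
  upperBound S legal =
    let p , e , inv = invariant-ʳ++ S invariant-[] legal
    in  p , e ,
        subst (_≤ p * g + e) length≡ (≤-trans (m≤m+n _ _) (lengthBound inv)) ,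
        ≤-trans (coverBound inv) (count<-≤ (n + m) _) ,
        (λ 1≤p → ≤-trans (nearBound inv 1≤p) (count<-≤ n _)) ,
        (λ p≡0 → trans (sym length≡) (cong length (emptyIfNoFresh inv p≡0)))
    where
    length≡ : length (S ʳ++ []) ≡ length S
    length≡ = trans (length-ʳ++ S) (+-identityʳ (length S))

module LexPlacement (m n k : ℕ) (H : SimpleGraph k) where

  open LexNeighbourhood m n k H

  layerCopy : Fin n → List (Fin k) → List Vertex
  layerCopy ℓ = map (ℓ ,_)

  legalFrom-layerCopy : ∀ ℓ histH far S → LegalFrom HG histH S → (∀ w → w ∈ far → m < dist (layerOf w) (toℕ ℓ)) →
                        LegalFrom G (layerCopy ℓ histH ++ far) (layerCopy ℓ S)
  legalFrom-layerCopy ℓ histH far []      _                          _    = tt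
  legalFrom-layerCopy ℓ histH far (h ∷ S) ((u , hu , undom) , legal) isFar =
    ((ℓ , u) , InN-lex-within ℓ h u hu , undom′) , legalFrom-layerCopy ℓ (h ∷ histH) far S legal isFar
    where
    undom′ : ¬ Dominated G (layerCopy ℓ histH ++ far) (ℓ , u)
    undom′ ((j , y) , w∈ , yu) with ∈-++⁻ (layerCopy ℓ histH) w∈
    ... | inj₂ w∈far = ¬InN-lex-far j y ℓ u (isFar (j , y) w∈far) yu
    ... | inj₁ w∈copy with ∈-map⁻ (ℓ ,_) w∈copy | InN-lex⁻ j y ℓ u yu
    ...   | _ , y∈ , refl | inj₁ (ℓ≢ℓ , _) = ℓ≢ℓ refl
    ...   | _ , y∈ , refl | inj₂ (_ , yu′) = undom (y , y∈ , yu′)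

  undominated-above : ∀ hist i x → (∀ w → w ∈ hist → layerOf w + suc m ≤ toℕ i) → ¬ Dominated G hist (i , x)
  undominated-above hist i x below ((j , y) , w∈ , yx) =
    ¬InN-lex-far j y i x (far⇒dist> (toℕ j) (toℕ i) (below (j , y) w∈)) yx

module Construction (m n k : ℕ) (H : SimpleGraph k) (1≤m : 1 ≤ m) (r b : ℕ) (1≤b : 1 ≤ b)
                    (n≡ : n ≡ suc (r + b * suc m)) (S₁ : List (Fin k)) (legalS₁ : LegalFrom (toGraph H) [] S₁)
                    (u : Fin k) (u-undominated : ¬ Dominated (toGraph H) (S₁ ʳ++ []) u) where

  open LexNeighbourhood m n k H
  open LexPlacement m n k H

  0<n : 0 < n
  0<n = subst (0 <_) (sym n≡) (s≤s z≤n)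

  -- positions outside [0, n) are sent to 0; only positions below n are ever used
  pos : ℕ → Fin n
  pos x with x <? n
  ... | yes x<n = Fin.fromℕ< x<n
  ... | no _    = Fin.fromℕ< 0<n

  toℕ-pos : ∀ {x} → x < n → toℕ (pos x) ≡ x
  toℕ-pos {x} x<n with x <? n
  ... | yes x<n′ = Fin.toℕ-fromℕ< x<n′
  ... | no  x≮n  = ⊥-elim (x≮n x<n)

  peak : ℕ → ℕ
  peak a = r + a * suc m

  peak-suc : ∀ a → peak (suc a) ≡ peak a + suc m
  peak-suc a = shift r a m
    where
    shift : ∀ r a m → r + suc a * suc m ≡ r + a * suc m + suc m
    shift = solve-∀

  peak<n : ∀ {a} → a ≤ b → peak a < n
  peak<n a≤b = subst (_ <_) (sym n≡) (s≤s (+-monoʳ-≤ r (*-monoˡ-≤ (suc m) a≤b)))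

  m≤peak : ∀ {a} → 1 ≤ a → m ≤ peak a
  m≤peak {a} 1≤a = ≤-trans (≤-trans (n≤1+n m) (m≤n*m (suc m) a ⦃ >-nonZero 1≤a ⦄)) (m≤n+m (a * suc m) r)

  r+m<n : r + m < n
  r+m<n = subst (r + m <_) (sym n≡) (s≤s (+-monoʳ-≤ r (≤-trans (n≤1+n m) (m≤n*m (suc m) b ⦃ >-nonZero 1≤b ⦄))))

  start : List Vertex
  start = layerCopy (pos 0) (S₁ ++ u ∷ [])

  -- the vertex at position j footprints (j + m, u)
  sweep : ℕ → ℕ → List Vertex
  sweep j zero    = []
  sweep j (suc c) = (pos j , u) ∷ sweep (suc j) c

  connector : ℕ → Vertex
  connector a = pos (peak a ∸ m) , u

  block : ℕ → List Vertex
  block a = layerCopy (pos (peak a)) S₁ ++ connector a ∷ []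

  blocks : ℕ → ℕ → List Vertex
  blocks a zero    = []
  blocks a (suc c) = block a ++ blocks (suc a) c

  sequence : List Vertex
  sequence = start ++ sweep 1 r ++ blocks 1 b

  Below : ℕ → List Vertex → Set
  Below X hist = ∀ w → w ∈ hist → layerOf w < X

  FarBelow : ℕ → List Vertex → Set
  FarBelow a hist = ∀ w → w ∈ hist → layerOf w + suc m ≤ peak a

  sweep-legal : ∀ c j hist → j + c ≤ suc r → Below j hist →
                LegalFrom G hist (sweep j c) × Below (j + c) (sweep j c ʳ++ hist)
  sweep-legal zero    j hist _     below = tt , subst (λ X → Below X hist) (sym (+-identityʳ j)) below
  sweep-legal (suc c) j hist j+c≤ below =
    (((pos (j + m) , u) , InN-lex-across (pos j) u (pos (j + m)) u j≢j+m close , undom) , proj₁ rest) ,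
    subst (λ X → Below X (sweep (suc j) c ʳ++ (pos j , u) ∷ hist)) (sym (+-suc j c)) (proj₂ rest)
    where
    j≤r : j ≤ r
    j≤r = s≤s⁻¹ (≤-trans (s≤s (m≤m+n j c)) (≤-trans (≤-reflexive (sym (+-suc j c))) j+c≤))
    toℕ-j : toℕ (pos j) ≡ j
    toℕ-j = toℕ-pos (≤-trans (s≤s (≤-trans j≤r (m≤m+n r m))) r+m<n)
    toℕ-j+m : toℕ (pos (j + m)) ≡ j + m
    toℕ-j+m = toℕ-pos (≤-trans (s≤s (+-monoˡ-≤ m j≤r)) r+m<n)
    j≢j+m : ¬ toℕ (pos j) ≡ toℕ (pos (j + m))
    j≢j+m eq = <⇒≢ (m<m+n j 1≤m) (trans (sym toℕ-j) (trans eq toℕ-j+m))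
    close : dist (toℕ (pos j)) (toℕ (pos (j + m))) ≤ m
    close rewrite toℕ-j | toℕ-j+m = ≤⇒dist≤ j (j + m) (≤-trans (m≤m+n j m) (m≤m+n (j + m) m)) ≤-refl
    undom : ¬ Dominated G hist (pos (j + m) , u)
    undom = undominated-above hist (pos (j + m)) u λ w w∈ →
      subst (layerOf w + suc m ≤_) (sym toℕ-j+m)
            (≤-trans (≤-reflexive (+-suc (layerOf w) m)) (+-monoˡ-≤ m (below w w∈)))
    rest : LegalFrom G ((pos j , u) ∷ hist) (sweep (suc j) c) ×
           Below (suc j + c) (sweep (suc j) c ʳ++ (pos j , u) ∷ hist)
    rest = sweep-legal c (suc j) ((pos j , u) ∷ hist) (≤-trans (≤-reflexive (sym (+-suc j c))) j+c≤)
             λ { w (here refl) → subst (_< suc j) (sym toℕ-j) ≤-refl ; w (there w∈) → m≤n⇒m≤1+n (below w w∈) }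

  ≤peak⇒farBelow : ∀ a w → layerOf w ≤ peak a → layerOf w + suc m ≤ peak (suc a)
  ≤peak⇒farBelow a w ≤peak = ≤-trans (+-monoˡ-≤ (suc m) ≤peak) (≤-reflexive (sym (peak-suc a)))

  module _ {a : ℕ} (1≤a : 1 ≤ a) (a≤b : a ≤ b) where

    toℕ-peak : toℕ (pos (peak a)) ≡ peak a
    toℕ-peak = toℕ-pos (peak<n a≤b)

    toℕ-connector : layerOf (connector a) ≡ peak a ∸ m
    toℕ-connector = toℕ-pos (≤-trans (s≤s (m∸n≤m (peak a) m)) (peak<n a≤b))

    connector→peak : InN G (connector a) (pos (peak a) , u)
    connector→peak = InN-lex-across (pos (peak a ∸ m)) u (pos (peak a)) u
      (λ eq → <⇒≢ (∸-monoʳ-< {peak a} {m} {0} 1≤m (m≤peak 1≤a)) (trans (sym toℕ-connector) (trans eq toℕ-peak)))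
      (subst₂ (λ c l → dist c l ≤ m) (sym toℕ-connector) (sym toℕ-peak)
              (≤⇒dist≤ (peak a ∸ m) (peak a) (≤-trans (m∸n≤m (peak a) m) (m≤m+n (peak a) m))
                                             (≤-reflexive (sym (m∸n+n≡m (m≤peak 1≤a))))))

    module _ {hist : List Vertex} (farBelow : FarBelow a hist) where

      farFromPeak : ∀ w → w ∈ hist → layerOf w + suc m ≤ toℕ (pos (peak a))
      farFromPeak w w∈ = subst (layerOf w + suc m ≤_) (sym toℕ-peak) (farBelow w w∈)

      -- inside the peak layer the copy of S₁ does not dominate u, and earlier vertices are too far below
      peak-undominated : ¬ Dominated G (layerCopy (pos (peak a)) S₁ ʳ++ hist) (pos (peak a) , u)
      peak-undominated ((j , x) , w∈ , xu) with ∈-ʳ++⁻ (layerCopy (pos (peak a)) S₁) hist w∈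
      ... | inj₂ w∈hist = undominated-above hist (pos (peak a)) u farFromPeak ((j , x) , w∈hist , xu)
      ... | inj₁ w∈copy with ∈-map⁻ (pos (peak a) ,_) w∈copy | InN-lex⁻ j x (pos (peak a)) u xu
      ...   | _ , x∈ , refl | inj₁ (ℓ≢ℓ , _) = ℓ≢ℓ refl
      ...   | _ , x∈ , refl | inj₂ (_ , xu′) = u-undominated (x , Any.reverseAcc⁺ [] S₁ (inj₂ x∈) , xu′)

      block-legal : LegalFrom G hist (block a)
      block-legal =
        legalFrom-++ G hist (layerCopy (pos (peak a)) S₁) (connector a ∷ [])
          (legalFrom-layerCopy (pos (peak a)) [] hist S₁ legalS₁ λ w w∈ → far⇒dist> (layerOf w) _ (farFromPeak w w∈))
          (((pos (peak a) , u) , connector→peak , peak-undominated) , tt)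

      block-farBelow : FarBelow (suc a) (block a ʳ++ hist)
      block-farBelow w w∈ with ∈-ʳ++⁻ (block a) hist w∈
      ... | inj₂ w∈hist = ≤peak⇒farBelow a w (≤-trans (m≤m+n (layerOf w) (suc m)) (farBelow w w∈hist))
      ... | inj₁ w∈block with ∈-++⁻ (layerCopy (pos (peak a)) S₁) w∈block
      ...   | inj₂ (here refl) = ≤peak⇒farBelow a w (≤-trans (≤-reflexive toℕ-connector) (m∸n≤m (peak a) m))
      ...   | inj₁ w∈copy with ∈-map⁻ (pos (peak a) ,_) w∈copy
      ...     | _ , _ , refl = ≤peak⇒farBelow a w (≤-reflexive toℕ-peak)

  blocks-legal : ∀ c a hist → 1 ≤ a → a + c ≤ suc b → FarBelow a hist → LegalFrom G hist (blocks a c)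
  blocks-legal zero    a hist _   _    _        = tt
  blocks-legal (suc c) a hist 1≤a a+c≤ farBelow =
    legalFrom-++ G hist (block a) (blocks (suc a) c) (block-legal 1≤a a≤b farBelow)
      (blocks-legal c (suc a) (block a ʳ++ hist) (s≤s z≤n) (≤-trans (≤-reflexive (sym (+-suc a c))) a+c≤)
                    (block-farBelow 1≤a a≤b farBelow))
    where
    a≤b : a ≤ b
    a≤b = s≤s⁻¹ (≤-trans (s≤s (m≤m+n a c)) (≤-trans (≤-reflexive (sym (+-suc a c))) a+c≤))

  sequence-legal : LegalFrom G [] sequence
  sequence-legal =
    legalFrom-++ G [] start (sweep 1 r ++ blocks 1 b) start-legal
      (legalFrom-++ G hist₀ (sweep 1 r) (blocks 1 b) (proj₁ swept) (blocks-legal b 1 hist₁ ≤-refl ≤-refl farBelow₁))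
    where
    start-legal : LegalFrom G [] start
    start-legal = legalFrom-layerCopy (pos 0) [] [] (S₁ ++ u ∷ [])
                    (legalFrom-++ HG [] S₁ (u ∷ []) legalS₁ ((u , inj₁ refl , u-undominated) , tt)) (λ _ ())
    hist₀ : List Vertex
    hist₀ = start ʳ++ []
    below₀ : Below 1 hist₀
    below₀ w w∈ with ∈-ʳ++⁻ start [] w∈
    ... | inj₁ w∈start with ∈-map⁻ (pos 0 ,_) w∈start
    ...   | _ , _ , refl = s≤s (≤-reflexive (toℕ-pos 0<n))
    swept : LegalFrom G hist₀ (sweep 1 r) × Below (1 + r) (sweep 1 r ʳ++ hist₀)
    swept = sweep-legal r 1 hist₀ ≤-refl below₀
    hist₁ : List Vertex
    hist₁ = sweep 1 r ʳ++ hist₀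
    farBelow₁ : FarBelow 1 hist₁
    farBelow₁ w w∈ = ≤-trans (+-monoˡ-≤ (suc m) (s≤s⁻¹ (proj₂ swept w w∈)))
                             (≤-reflexive (cong (r +_) (sym (*-identityˡ (suc m)))))

  length-layerCopy-∷ʳ : ∀ ℓ z → length (layerCopy ℓ S₁ ++ z ∷ []) ≡ suc (length S₁)
  length-layerCopy-∷ʳ ℓ z =
    trans (length-++ (layerCopy ℓ S₁)) (trans (cong (_+ 1) (length-map _ S₁)) (+-comm (length S₁) 1))

  length-sweep : ∀ j c → length (sweep j c) ≡ c
  length-sweep j zero    = refl
  length-sweep j (suc c) = cong suc (length-sweep (suc j) c)

  length-blocks : ∀ a c → length (blocks a c) ≡ c * suc (length S₁)
  length-blocks a zero    = refl
  length-blocks a (suc c) =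
    trans (length-++ (block a))
          (cong₂ _+_ (length-layerCopy-∷ʳ (pos (peak a)) (connector a)) (length-blocks (suc a) c))

  length-sequence : length sequence ≡ suc (length S₁) + (r + b * suc (length S₁))
  length-sequence = begin
    length sequence                                               ≡⟨ length-++ start ⟩
    length start + length (sweep 1 r ++ blocks 1 b)               ≡⟨ cong₂ _+_ length-start (length-++ (sweep 1 r)) ⟩
    suc (length S₁) + (length (sweep 1 r) + length (blocks 1 b))  ≡⟨ cong (suc (length S₁) +_) lengths ⟩
    suc (length S₁) + (r + b * suc (length S₁))                   ∎
    where
    open ≡-Reasoning
    length-start : length start ≡ suc (length S₁)
    length-start = trans (cong length (map-++ (pos 0 ,_) S₁ (u ∷ []))) (length-layerCopy-∷ʳ (pos 0) (pos 0 , u))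
    lengths : length (sweep 1 r) + length (blocks 1 b) ≡ r + b * suc (length S₁)
    lengths = cong₂ _+_ (length-sweep 1 r) (length-blocks 1 b)

  lowerBound : ∃ λ S → LegalDominating G S × suc (length S₁) + (r + b * suc (length S₁)) ≤ length S
  lowerBound =
    let S , legalDom , len≤ = legalHistory⇒legalDominating G vertices ∈-vertices (sequence ʳ++ [])
                                (legalHistory-ʳ++ G [] sequence sequence-legal tt)
    in  S , legalDom , subst (_≤ length S) (trans (length-ʳ++ sequence) (trans (+-identityʳ _) length-sequence)) len≤

*≤⇒≤/ : ∀ p c N .{{_ : NonZero c}} → p * c ≤ N → p ≤ N / c
*≤⇒≤/ p c N p*c≤N = subst (_≤ N / c) (m*n/n≡m p c) (/-monoˡ-≤ c p*c≤N)

cost-large : ∀ {L p e q N} g′ c → L ≤ p * (g′ + c) + e → c * p + e ≤ N → p ≤ q → L ≤ q * g′ + N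
cost-large {L} {p} {e} {q} {N} g′ c L≤ cost≤N p≤q = begin
  L                     ≤⟨ L≤ ⟩
  p * (g′ + c) + e      ≡⟨ split p g′ c e ⟩
  p * g′ + (c * p + e)  ≤⟨ +-mono-≤ (*-monoˡ-≤ g′ p≤q) cost≤N ⟩
  q * g′ + N            ∎
  where
  open ≤-Reasoning
  split : ∀ p g′ c e → p * (g′ + c) + e ≡ p * g′ + (c * p + e)
  split = solve-∀

cost-small-single : ∀ {L g e} m n → 1 ≤ g → L ≤ 1 * g + e → m + 1 + e ≤ n → L + (m + 2) ≤ 2 * g + n
cost-small-single {L} {g} {e} m n 1≤g L≤ cost≤n = begin
  L + (m + 2)          ≤⟨ +-monoˡ-≤ (m + 2) L≤ ⟩
  1 * g + e + (m + 2)  ≡⟨ regroup g e m ⟩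
  g + 1 + (m + 1 + e)  ≤⟨ +-mono-≤ (+-monoʳ-≤ g 1≤g) cost≤n ⟩
  g + g + n            ≡⟨ cong (λ x → g + x + n) (sym (+-identityʳ g)) ⟩
  2 * g + n            ∎
  where
  open ≤-Reasoning
  regroup : ∀ g e m → 1 * g + e + (m + 2) ≡ g + 1 + (m + 1 + e)
  regroup = solve-∀

cost-small-many : ∀ {L g e} m n d → g ≤ m → L ≤ (2 + d) * g + e → suc m * (2 + d) + e ≤ n + m →
                  L + (m + 2) ≤ 2 * g + n
cost-small-many {L} {g} {e} m n d g≤m L≤ cost≤ = begin
  L + (m + 2)                        ≤⟨ +-monoˡ-≤ (m + 2) L≤ ⟩
  (2 + d) * g + e + (m + 2)          ≡⟨ regroup d g e m ⟩
  2 * g + (d * g + (e + m + 2))      ≤⟨ +-monoʳ-≤ (2 * g) (+-monoˡ-≤ (e + m + 2) (*-monoʳ-≤ d g≤1+m)) ⟩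
  2 * g + (d * suc m + (e + m + 2))  ≤⟨ +-monoʳ-≤ (2 * g) (+-cancelʳ-≤ m _ n rest≤n+m) ⟩
  2 * g + n                          ∎
  where
  open ≤-Reasoning
  regroup : ∀ d g e m → (2 + d) * g + e + (m + 2) ≡ 2 * g + (d * g + (e + m + 2))
  regroup = solve-∀
  regroup′ : ∀ d m e → d * suc m + (e + m + 2) + m ≡ suc m * (2 + d) + e
  regroup′ = solve-∀
  g≤1+m : g ≤ suc m
  g≤1+m = ≤-trans g≤m (n≤1+n m)
  rest≤n+m : d * suc m + (e + m + 2) + m ≤ n + m
  rest≤n+m = ≤-trans (≤-reflexive (regroup′ d m e)) cost≤

blockDecomposition : ∀ m n → m + 2 ≤ n →
                     ∃₂ λ r b → 1 ≤ b × suc b ≡ (n + m) / suc m × n ≡ suc (r + b * suc m)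
blockDecomposition m n m+2≤n = n ∸ suc (b * suc m) , b , ∸-monoˡ-≤ 1 2≤q , 1+b≡q , n≡
  where
  q : ℕ
  q = (n + m) / suc m
  2≤q : 2 ≤ q
  2≤q = *≤⇒≤/ 2 (suc m) (n + m) (≤-trans (≤-reflexive (double m)) (+-monoˡ-≤ m m+2≤n))
    where
    double : ∀ m → 2 * suc m ≡ m + 2 + m
    double = solve-∀
  b : ℕ
  b = q ∸ 1
  1+b≡q : suc b ≡ q
  1+b≡q = trans (+-comm 1 b) (m∸n+n≡m (≤-trans (n≤1+n 1) 2≤q))
  blocks≤n : suc (b * suc m) ≤ n
  blocks≤n = +-cancelʳ-≤ m _ n (begin
    suc (b * suc m) + m  ≡⟨ +-comm (suc (b * suc m)) m ⟩
    m + suc (b * suc m)  ≡⟨ +-suc m (b * suc m) ⟩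
    suc b * suc m        ≡⟨ cong (_* suc m) 1+b≡q ⟩
    q * suc m            ≤⟨ m/n*n≤m (n + m) (suc m) ⟩
    n + m                ∎)
    where open ≤-Reasoning
  n≡ : n ≡ suc (n ∸ suc (b * suc m) + b * suc m)
  n≡ = sym (trans (sym (+-suc (n ∸ suc (b * suc m)) (b * suc m))) (m∸n+n≡m blocks≤n))

module LexPathPowerGrundy (m n k : ℕ) (1≤m : 1 ≤ m) (m+2≤n : m + 2 ≤ n) (1≤k : 1 ≤ k) (H : SimpleGraph k) (g : ℕ)
                          (grundy : IsGrundyDom (toGraph H) g) where

  open LexNeighbourhood m n k H

  legalH≤g : ∀ hist → LegalHistory HG hist → length hist ≤ g
  legalH≤g = legalHistory-length≤ HG (allFin k) ∈-allFin grundy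

  1+m≤n : suc m ≤ n
  1+m≤n = ≤-trans (≤-reflexive (+-comm 1 m)) (≤-trans (+-monoʳ-≤ m (n≤1+n 1)) m+2≤n)

  module Upper = UpperBound m n k H g legalH≤g 1+m≤n

  1≤g : 1 ≤ g
  1≤g = Upper.g≥1 (Fin.fromℕ< 1≤k)

  accounting : ∀ S → LegalDominating G S → Upper.Accounting (length S)
  accounting S (_ , legal , _) = Upper.upperBound S legal

  longSequence : ∀ r b → 1 ≤ b → n ≡ suc (r + b * suc m) → ∃ λ S → LegalDominating G S × g + (r + b * g) ≤ length S
  longSequence r b 1≤b n≡ with proj₁ grundy
  ... | SH , (_ , legalSH , _) , lengthSH with initLast SH
  ...   | [] = ⊥-elim (<⇒≢ 1≤g lengthSH)
  ...   | S₁ ∷ʳ′ y with legalFrom-++⁻ HG [] S₁ (y ∷ []) legalSH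
  ...     | legalS₁ , ((u , _ , u-undominated) , _) =
    let S , legalDom , len≤ = Construction.lowerBound m n k H 1≤m r b 1≤b n≡ S₁ legalS₁ u u-undominated
    in  S , legalDom , subst (λ c → c + (r + b * c) ≤ length S) g≡ len≤
    where
    g≡ : suc (length S₁) ≡ g
    g≡ = trans (trans (+-comm 1 (length S₁)) (sym (length-++ S₁))) lengthSH

  grundy-large : suc m ≤ g → IsGrundyDom G ((n + m) / suc m * (g ∸ suc m) + n + m)
  grundy-large 1+m≤g with blockDecomposition m n m+2≤n
  ... | r , b , 1≤b , 1+b≡q , n≡ =
    let S , legalDom , len≤ = longSequence r b 1≤b n≡
    in  isGrundyDom-intro G _ maximal (S , legalDom , ≤-trans (≤-reflexive (sym length≡)) len≤)
    where
    q : ℕ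
    q = (n + m) / suc m
    g′ : ℕ
    g′ = g ∸ suc m
    g≡ : g ≡ g′ + suc m
    g≡ = sym (m∸n+n≡m 1+m≤g)
    maximal : ∀ S → LegalDominating G S → length S ≤ q * g′ + n + m
    maximal S legalDom =
      let p , e , L≤ , cost≤ , _ = accounting S legalDom
          p≤q = *≤⇒≤/ p (suc m) (n + m) (≤-trans (≤-reflexive (*-comm p (suc m))) (≤-trans (m≤m+n _ e) cost≤))
      in  subst (length S ≤_) (sym (+-assoc (q * g′) n m))
                (cost-large g′ (suc m) (subst (λ c → length S ≤ p * c + e) g≡ L≤) cost≤ p≤q)
    length≡ : g + (r + b * g) ≡ q * g′ + n + m
    length≡ = begin
      g + (r + b * g)                             ≡⟨ cong (λ c → c + (r + b * c)) g≡ ⟩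
      g′ + suc m + (r + b * (g′ + suc m))         ≡⟨ regroup g′ m r b ⟩
      suc b * g′ + suc (r + b * suc m) + m        ≡⟨ cong₂ (λ c N → c * g′ + N + m) 1+b≡q (sym n≡) ⟩
      q * g′ + n + m                              ∎
      where
      open ≡-Reasoning
      regroup : ∀ g′ m r b → g′ + suc m + (r + b * (g′ + suc m)) ≡ suc b * g′ + suc (r + b * suc m) + m
      regroup = solve-∀

  grundy-small : g ≤ m → IsGrundyDom G (2 * g + n ∸ (m + 2))
  grundy-small g≤m =
    let S , legalDom , len≤ = longSequence r 1 ≤-refl n≡
    in  isGrundyDom-intro G _ maximal (S , legalDom , ≤-trans (≤-reflexive (sym length≡)) len≤)
    where
    maximal : ∀ S → LegalDominating G S → length S ≤ 2 * g + n ∸ (m + 2)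
    maximal S legalDom with accounting S legalDom
    ... | zero , _ , _ , _ , _ , empty = subst (_≤ _) (sym (empty refl)) z≤n
    ... | suc zero , _ , L≤ , _ , near≤ , _ =
      m+n≤o⇒m≤o∸n (length S) (cost-small-single m n 1≤g L≤ (near≤ (s≤s z≤n)))
    ... | suc (suc d) , _ , L≤ , cost≤ , _ , _ =
      m+n≤o⇒m≤o∸n (length S) (cost-small-many m n d g≤m L≤ cost≤)
    r : ℕ
    r = n ∸ (m + 2)
    n≡ : n ≡ suc (r + 1 * suc m)
    n≡ = trans (sym (m∸n+n≡m m+2≤n)) (regroup r m)
      where
      regroup : ∀ r m → r + (m + 2) ≡ suc (r + 1 * suc m)
      regroup = solve-∀
    length≡ : g + (r + 1 * g) ≡ 2 * g + n ∸ (m + 2)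
    length≡ = trans (regroup g r) (sym (+-∸-assoc (2 * g) m+2≤n))
      where
      regroup : ∀ g r → g + (r + 1 * g) ≡ 2 * g + r
      regroup = solve-∀

theorem6 : (m n k : ℕ) → 1 ≤ m → m + 2 ≤ n → 1 ≤ k → (H : SimpleGraph k) → (g : ℕ) →
    IsGrundyDom (toGraph H) g →
    ((suc m ≤ g → IsGrundyDom (lex (pathPow n m) (toGraph H)) (((n + m) / suc m) * (g ∸ suc m) + n + m))
     × (g ≤ m → IsGrundyDom (lex (pathPow n m) (toGraph H)) (2 * g + n ∸ (m + 2))))
theorem6 m n k 1≤m m+2≤n 1≤k H g grundy = grundy-large , grundy-small
  where open LexPathPowerGrundy m n k 1≤m m+2≤n 1≤k H g grundy
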